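{- Let $c\geq 2$, $\mathcal{C}=\{1,2c\}$, $p\geq 4$, and let $n$ be a positive integer such that $\mathcal{G}_{\mathcal{C}}(m)=s_c(m)$ for all $1\le m\le n$. If $v\in\mathcal{N}(n,p,\mathcal{C})$, then $v\oplus 1\in\mathcal{N}(n+1,p,\mathcal{C})$.
   Context: $\mathcal{G}_{\mathcal{C}}$ is the nim-sequence of \textsc{cut} with cut-set $\mathcal{C}$: $\mathcal{G}_{\mathcal{C}}(n)=\operatorname{mex}\{\mathcal{G}_{\mathcal{C}}(h_0)\oplus\cdots\oplus\mathcal{G}_{\mathcal{C}}(h_d): d\in\mathcal{C}, h_i\geq 1, \sum h_i=n\}$, with $\oplus$ bitwise XOR and mex the least nonnegative integer not in the set. The nim-set is $\mathcal{N}(n,p,\mathcal{C})=\{\mathcal{G}_{\mathcal{C}}(h_1)\oplus\cdots\oplus\mathcal{G}_{\mathcal{C}}(h_p): h_i\geq 1 \text{ integers}, h_1+\cdots+h_p=n\}$. The sequence $s_c$: for $n=12cq+m$, $q\ge0$, $1\le m\le 12c$, $s_c(n)=8q+t(m)$ with $t(m)=0/1$ for $1\le m\le 2c$ ($m$ odd/even), $2/3$ for $2c<m\le 4c$, $t(4c+1)=1$, $5/4$ for $4c+2\le m\le 6c$, $3/2$ for $6c<m\le 8c$, $4/5$ for $8c<m\le 10c$, $6/7$ for $10c<m\le 12c$ (odd/even respectively). -}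

module Defs where

open import Data.Nat using (ℕ; zero; suc; _+_; _*_; _∸_; _≤_; _≤ᵇ_; _≡ᵇ_; NonZero)
open import Data.Product using (Σ; _×_)
open import Relation.Binary.PropositionalEquality using (_≡_)
open import Data.Vec.Relation.Unary.All using (All)
open import Data.Nat.DivMod using (_/_; _%_)
open import Data.Bool using (Bool; true; false; if_then_else_)
open import Data.List using (List; []; _∷_; _++_; map; concatMap; length; foldr)
open import Data.Bool.ListAction using (any)
open import Data.Vec using (Vec)
import Data.Vec as V

-- Bitwise XOR on ℕ (fuel a + b bounds the number of binary digits).
xorF : ℕ → ℕ → ℕ → ℕ
xorF zero    _ _ = 0
xorF (suc f) a b =
  (if (a % 2) ≡ᵇ (b % 2) then 0 else 1) + 2 * xorF f (a / 2) (b / 2)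

_⊕_ : ℕ → ℕ → ℕ
a ⊕ b = xorF (a + b) a b

infixl 6 _⊕_

xorList : List ℕ → ℕ
xorList = foldr _⊕_ 0

-- mex: least natural not in the list (it is at most the length of the list)
mexAux : ℕ → ℕ → List ℕ → ℕ
mexAux zero    k xs = k
mexAux (suc f) k xs = if any (λ x → x ≡ᵇ k) xs then mexAux f (suc k) xs else k

mex : List ℕ → ℕ
mex xs = mexAux (suc (length xs)) 0 xs

comps : ℕ → ℕ → List (List ℕ)
comps zero    zero    = [] ∷ []
comps zero    (suc _) = []
comps (suc k) n = concatMap (λ h → map (h ∷_) (comps k (n ∸ h))) (range n)
  where
  range : ℕ → List ℕ
  range zero    = []
  range (suc m) = suc m ∷ range m

-- lookup with default: get xs m = (m-1)-th entry of xs (i.e. the value at heap size m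
-- when xs = [G 1, G 2, ...])
get : List ℕ → ℕ → ℕ
get xs m = go xs (m ∸ 1)
  where
  go : List ℕ → ℕ → ℕ
  go []       _       = 0
  go (x ∷ _)  zero    = x
  go (_ ∷ ys) (suc i) = go ys i

-- Options of a heap of size n in CUT with cut-set C, given a nim-value function g:
-- XORs g(h_0) ⊕ ... ⊕ g(h_d) over d ∈ C and compositions of n into d+1 positive parts.
options : List ℕ → (ℕ → ℕ) → ℕ → List ℕ
options C g n = concatMap (λ d → map (λ hs → xorList (map g hs)) (comps (suc d) n)) C

-- Gtab C n = [G_C(1), ..., G_C(n)]  (course-of-values recursion)
Gtab : List ℕ → ℕ → List ℕ
Gtab C zero    = []
Gtab C (suc n) = Gtab C n ++ (mex (options C (get (Gtab C n)) (suc n)) ∷ [])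

-- The nim-sequence G_C (G_C(0) is a junk value 0; only n ≥ 1 is meaningful)
G : List ℕ → ℕ → ℕ
G C n = get (Gtab C n) n

cutSet : ℕ → List ℕ
cutSet c = 1 ∷ 2 * c ∷ []

InNimSet : List ℕ → ℕ → ℕ → ℕ → Set
InNimSet C n p v =
  Σ (Vec ℕ p) λ h → All (λ x → 1 ≤ x) h × V.sum h ≡ n × xorList (V.toList (V.map (G C) h)) ≡ v

oddEven : ℕ → ℕ → ℕ → ℕ
oddEven m a b = if m % 2 ≡ᵇ 1 then a else b

t : ℕ → ℕ → ℕ
t c m =
  if m ≤ᵇ 2 * c then oddEven m 0 1
  else if m ≤ᵇ 4 * c then oddEven m 2 3
  else if m ≡ᵇ 4 * c + 1 then 1
  else if m ≤ᵇ 6 * c then oddEven m 5 4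
  else if m ≤ᵇ 8 * c then oddEven m 3 2
  else if m ≤ᵇ 10 * c then oddEven m 4 5
  else oddEven m 6 7

-- s c n for n ≥ 1, c ≥ 1: write n = 12cq + m with q ≥ 0, 1 ≤ m ≤ 12c;
-- then q = (n-1) div 12c and m = n - 12cq.  s_c(n) = 8q + t(m).
s : ℕ → ℕ → ℕ
s zero    n = 0   -- junk (c ≥ 1 is assumed)
s (suc k) n = 8 * q + t c (n ∸ 12 * c * q)
  where
  c : ℕ
  c = suc k
  q : ℕ
  q = (n ∸ 1) / (12 * c)

-- Write a heap size as h = 12c·Q + m with 1 ≤ m ≤ 12c. Where G agrees with s_c this gives
-- G(h) = 8Q + t(m), and t is constant on thirteen classes of residues: a segment (2ck, 2c(k+1)]
-- of the definition of t together with a parity of m (the residue 4c+1 being a class of its own).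
-- Each class has a least element, its base o + 2ck with 1 ≤ o ≤ 3, and all its other elements are
-- base + 2e.
--
-- Given heaps h₁, h₂, h₃, h₄, … of total n and nim-sum v, replace h₁, …, h₄ by a, a, b, z where
-- b is the base of a class λ₁ and z = 12c·(Q₁ ⊕ Q₂ ⊕ Q₃ ⊕ Q₄) + the base of a class λ₂, the classes
-- being chosen with t-values XORing to (t(m₁) ⊕ ⋯ ⊕ t(m₄)) ⊕ 1. The two heaps a cancel, and XOR
-- respects the split 8Q + t, so the nim-sum becomes v ⊕ 1. It remains that n + 1 − b − z is even
-- and positive: the high parts lose 12c·(Q₁ + ⋯ + Q₄ − Q₁ ⊕ ⋯ ⊕ Q₄) ≥ 0, the excesses 2e are
-- even, and the bases of λ₁, λ₂ fit into those of the four classes, uniformly in c ≥ 2 — a finite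
-- check over the classes.

module Submission where

open import Defs
open import Data.Nat
open import Data.Nat.Properties
open import Data.Nat.DivMod
open import Data.Nat.Divisibility using (divides-refl)
open import Data.Nat.Tactic.RingSolver using (solve-∀)
open import Data.Bool using (T; true; false; if_then_else_)
open import Data.Product using (Σ; _×_; _,_; proj₁; proj₂)
open import Data.Product.Properties using (≡-dec)
open import Data.Sum using (_⊎_; inj₁; inj₂)
open import Data.List using (List; []; _∷_; map; cartesianProductWith; deduplicate)
open import Data.List.Membership.Propositional using (_∈_)
open import Data.List.Membership.Propositional.Properties using (∈-deduplicate⁺; ∈-cartesianProductWith⁺; ∈-map⁺)
open import Data.List.Relation.Unary.All using (All; all?; lookup)
open import Data.List.Relation.Unary.Any using (here; there)
open import Data.Vec using (_∷_)
import Data.Vec as V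
open import Data.Vec.Relation.Unary.All using (_∷_)
open import Relation.Binary.Definitions using (DecidableEquality)
open import Relation.Binary.PropositionalEquality
open import Relation.Nullary using (¬_)
open import Relation.Nullary.Decidable using (Dec; True; yes; no; _×-dec_; toWitness; dec-true; dec-false)

-- Parity and XOR

xorBit : ℕ → ℕ → ℕ
xorBit i j = if i ≡ᵇ j then 0 else 1

n≡n%2+2*[n/2] : ∀ n → n ≡ n % 2 + 2 * (n / 2)
n≡n%2+2*[n/2] n = trans (m≡m%n+[m/n]*n n 2) (cong (n % 2 +_) (*-comm (n / 2) 2))

[m+2n]%2≡m%2 : ∀ m n → (m + 2 * n) % 2 ≡ m % 2
[m+2n]%2≡m%2 m n = trans (cong (λ k → (m + k) % 2) (*-comm 2 n)) ([m+kn]%n≡m%n m n 2)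

[m+2n]/2≡m/2+n : ∀ m n → (m + 2 * n) / 2 ≡ m / 2 + n
[m+2n]/2≡m/2+n m n = begin
  (m + 2 * n) / 2 ≡⟨ cong (λ k → (m + k) / 2) (*-comm 2 n) ⟩
  (m + n * 2) / 2 ≡⟨ +-distrib-/-∣ʳ m (divides-refl n) ⟩
  m / 2 + n * 2 / 2 ≡⟨ cong (m / 2 +_) (m*n/n≡m n 2) ⟩
  m / 2 + n ∎
  where open ≡-Reasoning

[b+2m]%2≡b : ∀ {b} m → b < 2 → (b + 2 * m) % 2 ≡ b
[b+2m]%2≡b {0} m _ = [m+2n]%2≡m%2 0 m
[b+2m]%2≡b {1} m _ = [m+2n]%2≡m%2 1 m
[b+2m]%2≡b {2+ _} m (s≤s (s≤s ()))

[b+2m]/2≡m : ∀ {b} m → b < 2 → (b + 2 * m) / 2 ≡ m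
[b+2m]/2≡m {0} m _ = [m+2n]/2≡m/2+n 0 m
[b+2m]/2≡m {1} m _ = [m+2n]/2≡m/2+n 1 m
[b+2m]/2≡m {2+ _} m (s≤s (s≤s ()))

%2-cases : ∀ n → n % 2 ≡ 0 ⊎ n % 2 ≡ 1
%2-cases n with n % 2 | m%n<n n 2
... | 0 | _ = inj₁ refl
... | 1 | _ = inj₂ refl
... | suc (suc _) | s≤s (s≤s ())

≤-parity-step : ∀ {b m} → b ≤ m → m % 2 ≢ b % 2 → suc b ≤ m
≤-parity-step b≤m m≢b = ≤∧≢⇒< b≤m (λ b≡m → m≢b (cong (_% 2) (sym b≡m)))

same-parity-above : ∀ {b m} → b ≤ m → m % 2 ≡ b % 2 → Σ ℕ λ e → m ≡ b + 2 * e
same-parity-above {b} {m} b≤m m≡b = m / 2 ∸ b / 2 , (begin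
  m                                                  ≡⟨ n≡n%2+2*[n/2] m ⟩
  m % 2 + 2 * (m / 2)                                ≡⟨ cong₂ (λ i x → i + 2 * x) (sym m≡b) (m+[n∸m]≡n (/-monoˡ-≤ 2 b≤m)) ⟨
  b % 2 + 2 * (b / 2 + (m / 2 ∸ b / 2))              ≡⟨ regroup (b % 2) (b / 2) (m / 2 ∸ b / 2) ⟩
  (b % 2 + 2 * (b / 2)) + 2 * (m / 2 ∸ b / 2)        ≡⟨ cong (_+ 2 * (m / 2 ∸ b / 2)) (n≡n%2+2*[n/2] b) ⟨
  b + 2 * (m / 2 ∸ b / 2)                            ∎)
  where
  open ≡-Reasoning
  regroup : ∀ i x y → i + 2 * (x + y) ≡ (i + 2 * x) + 2 * y
  regroup = solve-∀

xorBit<2 : ∀ i j → xorBit i j < 2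
xorBit<2 i j with i ≡ᵇ j
... | true  = s≤s z≤n
... | false = s≤s (s≤s z≤n)

half-≤ : ∀ {m k} → m ≤ suc k → m / 2 ≤ k
half-≤ {m} {k} m≤1+k = ≤-pred (≤-<-trans (/-monoˡ-≤ 2 m≤1+k) (m/n<m (suc k) 2 ≤-refl))

xorF-fuel : ∀ f g {a b} → a ≤ f → b ≤ f → a ≤ g → b ≤ g → xorF f a b ≡ xorF g a b
xorF-fuel zero    zero    _   _   _   _   = refl
xorF-fuel zero    (suc g) z≤n z≤n _   _   = cong (2 *_) (xorF-fuel zero g z≤n z≤n z≤n z≤n)
xorF-fuel (suc f) zero    _   _   z≤n z≤n = cong (2 *_) (xorF-fuel f zero z≤n z≤n z≤n z≤n)
xorF-fuel (suc f) (suc g) {a} {b} a≤f b≤f a≤g b≤g =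
  cong (λ x → xorBit (a % 2) (b % 2) + 2 * x)
    (xorF-fuel f g (half-≤ a≤f) (half-≤ b≤f) (half-≤ a≤g) (half-≤ b≤g))

⊕-unfold : ∀ a b → a ⊕ b ≡ xorBit (a % 2) (b % 2) + 2 * (a / 2 ⊕ b / 2)
⊕-unfold zero    zero    = refl
⊕-unfold (suc a) b       = cong (λ x → xorBit (suc a % 2) (b % 2) + 2 * x)
  (xorF-fuel (a + b) (suc a / 2 + b / 2) (half-≤ (m≤m+n (suc a) b)) (half-≤ (m≤n+m b (suc a)))
    (m≤m+n _ _) (m≤n+m _ _))
⊕-unfold zero    (suc b) = cong (λ x → xorBit 0 (suc b % 2) + 2 * x)
  (xorF-fuel b (suc b / 2) z≤n (half-≤ ≤-refl) z≤n ≤-refl)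

⊕-%2 : ∀ a b → (a ⊕ b) % 2 ≡ xorBit (a % 2) (b % 2)
⊕-%2 a b = trans (cong (_% 2) (⊕-unfold a b))
  ([b+2m]%2≡b {xorBit (a % 2) (b % 2)} (a / 2 ⊕ b / 2) (xorBit<2 (a % 2) (b % 2)))

⊕-/2 : ∀ a b → (a ⊕ b) / 2 ≡ a / 2 ⊕ b / 2
⊕-/2 a b = trans (cong (_/ 2) (⊕-unfold a b))
  ([b+2m]/2≡m {xorBit (a % 2) (b % 2)} (a / 2 ⊕ b / 2) (xorBit<2 (a % 2) (b % 2)))

xorBit-comm : ∀ a b → xorBit (a % 2) (b % 2) ≡ xorBit (b % 2) (a % 2)
xorBit-comm a b with %2-cases a | %2-cases b
... | inj₁ p | inj₁ q rewrite p | q = refl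
... | inj₁ p | inj₂ q rewrite p | q = refl
... | inj₂ p | inj₁ q rewrite p | q = refl
... | inj₂ p | inj₂ q rewrite p | q = refl

xorBit-assoc : ∀ a b c →
  xorBit (xorBit (a % 2) (b % 2)) (c % 2) ≡ xorBit (a % 2) (xorBit (b % 2) (c % 2))
xorBit-assoc a b c with %2-cases a | %2-cases b | %2-cases c
... | inj₁ p | inj₁ q | inj₁ r rewrite p | q | r = refl
... | inj₁ p | inj₁ q | inj₂ r rewrite p | q | r = refl
... | inj₁ p | inj₂ q | inj₁ r rewrite p | q | r = refl
... | inj₁ p | inj₂ q | inj₂ r rewrite p | q | r = refl
... | inj₂ p | inj₁ q | inj₁ r rewrite p | q | r = refl
... | inj₂ p | inj₁ q | inj₂ r rewrite p | q | r = refl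
... | inj₂ p | inj₂ q | inj₁ r rewrite p | q | r = refl
... | inj₂ p | inj₂ q | inj₂ r rewrite p | q | r = refl

xorBit-identityˡ : ∀ a → xorBit 0 (a % 2) ≡ a % 2
xorBit-identityˡ a with %2-cases a
... | inj₁ p rewrite p = refl
... | inj₂ p rewrite p = refl

xorBit-same : ∀ a → xorBit (a % 2) (a % 2) ≡ 0
xorBit-same a with %2-cases a
... | inj₁ p rewrite p = refl
... | inj₂ p rewrite p = refl

⊕-comm : ∀ a b → a ⊕ b ≡ b ⊕ a
⊕-comm a b = go (a + b) (m≤m+n a b) (m≤n+m b a)
  where
  go : ∀ k {a b} → a ≤ k → b ≤ k → a ⊕ b ≡ b ⊕ a
  go zero    z≤n z≤n = refl
  go (suc k) {a} {b} a≤ b≤ = begin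
    a ⊕ b                                          ≡⟨ ⊕-unfold a b ⟩
    xorBit (a % 2) (b % 2) + 2 * (a / 2 ⊕ b / 2)   ≡⟨ cong₂ (λ i x → i + 2 * x) (xorBit-comm a b) (go k (half-≤ a≤) (half-≤ b≤)) ⟩
    xorBit (b % 2) (a % 2) + 2 * (b / 2 ⊕ a / 2)   ≡⟨ ⊕-unfold b a ⟨
    b ⊕ a                                          ∎
    where open ≡-Reasoning

⊕-identityˡ : ∀ a → 0 ⊕ a ≡ a
⊕-identityˡ a = go a ≤-refl
  where
  go : ∀ k {a} → a ≤ k → 0 ⊕ a ≡ a
  go zero    z≤n = refl
  go (suc k) {a} a≤ = begin
    0 ⊕ a                                 ≡⟨ ⊕-unfold 0 a ⟩
    xorBit 0 (a % 2) + 2 * (0 ⊕ a / 2)    ≡⟨ cong₂ (λ i x → i + 2 * x) (xorBit-identityˡ a) (go k (half-≤ a≤)) ⟩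
    a % 2 + 2 * (a / 2)                   ≡⟨ n≡n%2+2*[n/2] a ⟨
    a                                     ∎
    where open ≡-Reasoning

⊕-identityʳ : ∀ a → a ⊕ 0 ≡ a
⊕-identityʳ a = trans (⊕-comm a 0) (⊕-identityˡ a)

⊕-same : ∀ a → a ⊕ a ≡ 0
⊕-same a = go a ≤-refl
  where
  go : ∀ k {a} → a ≤ k → a ⊕ a ≡ 0
  go zero    z≤n = refl
  go (suc k) {a} a≤ = trans (⊕-unfold a a)
    (cong₂ (λ i x → i + 2 * x) (xorBit-same a) (go k (half-≤ a≤)))

⊕-assoc : ∀ a b c → (a ⊕ b) ⊕ c ≡ a ⊕ (b ⊕ c)
⊕-assoc a b c = go (a + b + c) (≤-trans (m≤m+n a b) (m≤m+n _ c))
  (≤-trans (m≤n+m b a) (m≤m+n _ c)) (m≤n+m c _)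
  where
  go : ∀ k {a b c} → a ≤ k → b ≤ k → c ≤ k → (a ⊕ b) ⊕ c ≡ a ⊕ (b ⊕ c)
  go zero    z≤n z≤n z≤n = refl
  go (suc k) {a} {b} {c} a≤ b≤ c≤ = begin
    (a ⊕ b) ⊕ c
      ≡⟨ ⊕-unfold (a ⊕ b) c ⟩
    xorBit ((a ⊕ b) % 2) (c % 2) + 2 * ((a ⊕ b) / 2 ⊕ c / 2)
      ≡⟨ cong₂ (λ i x → xorBit i (c % 2) + 2 * (x ⊕ c / 2)) (⊕-%2 a b) (⊕-/2 a b) ⟩
    xorBit (xorBit (a % 2) (b % 2)) (c % 2) + 2 * ((a / 2 ⊕ b / 2) ⊕ c / 2)
      ≡⟨ cong₂ (λ i x → i + 2 * x) (xorBit-assoc a b c) (go k (half-≤ a≤) (half-≤ b≤) (half-≤ c≤)) ⟩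
    xorBit (a % 2) (xorBit (b % 2) (c % 2)) + 2 * (a / 2 ⊕ (b / 2 ⊕ c / 2))
      ≡⟨ cong₂ (λ i x → xorBit (a % 2) i + 2 * (a / 2 ⊕ x)) (⊕-%2 b c) (⊕-/2 b c) ⟨
    xorBit (a % 2) ((b ⊕ c) % 2) + 2 * (a / 2 ⊕ (b ⊕ c) / 2)
      ≡⟨ ⊕-unfold a (b ⊕ c) ⟨
    a ⊕ (b ⊕ c)
      ∎
    where open ≡-Reasoning

xorBit≤+ : ∀ a b → xorBit (a % 2) (b % 2) ≤ a % 2 + b % 2
xorBit≤+ a b with %2-cases a | %2-cases b
... | inj₁ p | inj₁ q rewrite p | q = z≤n
... | inj₁ p | inj₂ q rewrite p | q = ≤-refl
... | inj₂ p | inj₁ q rewrite p | q = ≤-refl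
... | inj₂ p | inj₂ q rewrite p | q = z≤n

⊕≤+ : ∀ a b → a ⊕ b ≤ a + b
⊕≤+ a b = go (a + b) (m≤m+n a b) (m≤n+m b a)
  where
  go : ∀ k {a b} → a ≤ k → b ≤ k → a ⊕ b ≤ a + b
  go zero    z≤n z≤n = z≤n
  go (suc k) {a} {b} a≤ b≤ = begin
    a ⊕ b                                             ≡⟨ ⊕-unfold a b ⟩
    xorBit (a % 2) (b % 2) + 2 * (a / 2 ⊕ b / 2)      ≤⟨ +-mono-≤ (xorBit≤+ a b) (*-monoʳ-≤ 2 (go k (half-≤ a≤) (half-≤ b≤))) ⟩
    (a % 2 + b % 2) + 2 * (a / 2 + b / 2)             ≡⟨ +-*-digits (a % 2) (b % 2) (a / 2) (b / 2) ⟩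
    (a % 2 + 2 * (a / 2)) + (b % 2 + 2 * (b / 2))     ≡⟨ cong₂ _+_ (n≡n%2+2*[n/2] a) (n≡n%2+2*[n/2] b) ⟨
    a + b                                             ∎
    where
    open ≤-Reasoning
    +-*-digits : ∀ i j x y → (i + j) + 2 * (x + y) ≡ (i + 2 * x) + (j + 2 * y)
    +-*-digits = solve-∀

half-<-2^ : ∀ k {m} → m < 2 ^ suc k → m / 2 < 2 ^ k
half-<-2^ k {m} m< = m<n*o⇒m/o<n (subst (m <_) (*-comm 2 (2 ^ k)) m<)

⊕-<-2^ : ∀ k {a b} → a < 2 ^ k → b < 2 ^ k → a ⊕ b < 2 ^ k
⊕-<-2^ zero    (s≤s z≤n) (s≤s z≤n) = s≤s z≤n
⊕-<-2^ (suc k) {a} {b} a< b< = begin-strict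
  a ⊕ b                                          ≡⟨ ⊕-unfold a b ⟩
  xorBit (a % 2) (b % 2) + 2 * (a / 2 ⊕ b / 2)   <⟨ digit+2*< (xorBit<2 (a % 2) (b % 2)) (⊕-<-2^ k (half-<-2^ k a<) (half-<-2^ k b<)) ⟩
  2 * 2 ^ k                                      ∎
  where
  open ≤-Reasoning
  digit+2*< : ∀ {i x n} → i < 2 → x < n → i + 2 * x < 2 * n
  digit+2*< {i} {x} {n} i<2 x<n = begin-strict
    i + 2 * x         <⟨ +-monoˡ-< (2 * x) i<2 ⟩
    2 + 2 * x         ≡⟨ *-distribˡ-+ 2 1 x ⟨
    2 * suc x         ≤⟨ *-monoʳ-≤ 2 x<n ⟩
    2 * n             ∎

⊕-blocks : ∀ k q r {a b} → a < 2 ^ k → b < 2 ^ k →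
  (2 ^ k * q + a) ⊕ (2 ^ k * r + b) ≡ 2 ^ k * (q ⊕ r) + (a ⊕ b)
⊕-blocks zero q r (s≤s z≤n) (s≤s z≤n)
  rewrite +-identityʳ (1 * q) | +-identityʳ (1 * r) | *-identityˡ q | *-identityˡ r =
  sym (trans (+-identityʳ (1 * (q ⊕ r))) (*-identityˡ (q ⊕ r)))
⊕-blocks (suc k) q r {a} {b} a< b< = begin
  (2 ^ suc k * q + a) ⊕ (2 ^ suc k * r + b)
    ≡⟨ ⊕-unfold (2 ^ suc k * q + a) (2 ^ suc k * r + b) ⟩
  xorBit ((2 ^ suc k * q + a) % 2) ((2 ^ suc k * r + b) % 2)
    + 2 * ((2 ^ suc k * q + a) / 2 ⊕ (2 ^ suc k * r + b) / 2)
    ≡⟨ cong₂ (λ i x → i + 2 * x) (cong₂ xorBit (low q a) (low r b)) (cong₂ _⊕_ (high q a) (high r b)) ⟩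
  xorBit (a % 2) (b % 2) + 2 * ((2 ^ k * q + a / 2) ⊕ (2 ^ k * r + b / 2))
    ≡⟨ cong (λ x → xorBit (a % 2) (b % 2) + 2 * x) (⊕-blocks k q r (half-<-2^ k a<) (half-<-2^ k b<)) ⟩
  xorBit (a % 2) (b % 2) + 2 * (2 ^ k * (q ⊕ r) + (a / 2 ⊕ b / 2))
    ≡⟨ regroup (xorBit (a % 2) (b % 2)) (2 ^ k) (q ⊕ r) (a / 2 ⊕ b / 2) ⟩
  2 ^ suc k * (q ⊕ r) + (xorBit (a % 2) (b % 2) + 2 * (a / 2 ⊕ b / 2))
    ≡⟨ cong (2 ^ suc k * (q ⊕ r) +_) (⊕-unfold a b) ⟨
  2 ^ suc k * (q ⊕ r) + (a ⊕ b)
    ∎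
  where
  open ≡-Reasoning
  regroup : ∀ i P X Y → i + 2 * (P * X + Y) ≡ 2 * P * X + (i + 2 * Y)
  regroup = solve-∀
  shift : ∀ q a → 2 ^ suc k * q + a ≡ a + 2 * (2 ^ k * q)
  shift q a = trans (+-comm _ a) (cong (a +_) (*-assoc 2 (2 ^ k) q))
  low : ∀ q a → (2 ^ suc k * q + a) % 2 ≡ a % 2
  low q a = trans (cong (_% 2) (shift q a)) ([m+2n]%2≡m%2 a (2 ^ k * q))
  high : ∀ q a → (2 ^ suc k * q + a) / 2 ≡ 2 ^ k * q + a / 2
  high q a = trans (cong (_/ 2) (shift q a)) (trans ([m+2n]/2≡m/2+n a (2 ^ k * q)) (+-comm (a / 2) _))

⊕-octets : ∀ q r {v w} → v < 8 → w < 8 → (8 * q + v) ⊕ (8 * r + w) ≡ 8 * (q ⊕ r) + (v ⊕ w)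
⊕-octets = ⊕-blocks 3

⊕-replace : ∀ x y z g₁ g₂ g₃ g₄ r → y ⊕ z ≡ ((g₁ ⊕ g₂) ⊕ (g₃ ⊕ g₄)) ⊕ 1 →
  x ⊕ (x ⊕ (y ⊕ (z ⊕ r))) ≡ (g₁ ⊕ (g₂ ⊕ (g₃ ⊕ (g₄ ⊕ r)))) ⊕ 1
⊕-replace x y z g₁ g₂ g₃ g₄ r y⊕z≡ = begin
  x ⊕ (x ⊕ (y ⊕ (z ⊕ r)))                 ≡⟨ ⊕-assoc x x _ ⟨
  (x ⊕ x) ⊕ (y ⊕ (z ⊕ r))                 ≡⟨ cong (_⊕ (y ⊕ (z ⊕ r))) (⊕-same x) ⟩
  0 ⊕ (y ⊕ (z ⊕ r))                       ≡⟨ ⊕-identityˡ _ ⟩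
  y ⊕ (z ⊕ r)                             ≡⟨ ⊕-assoc y z r ⟨
  (y ⊕ z) ⊕ r                             ≡⟨ cong (_⊕ r) y⊕z≡ ⟩
  (g ⊕ 1) ⊕ r                             ≡⟨ ⊕-assoc g 1 r ⟩
  g ⊕ (1 ⊕ r)                             ≡⟨ cong (g ⊕_) (⊕-comm 1 r) ⟩
  g ⊕ (r ⊕ 1)                             ≡⟨ ⊕-assoc g r 1 ⟨
  (g ⊕ r) ⊕ 1                             ≡⟨ cong (_⊕ 1) reassociate ⟩
  (g₁ ⊕ (g₂ ⊕ (g₃ ⊕ (g₄ ⊕ r)))) ⊕ 1      ∎
  where
  open ≡-Reasoning
  g : ℕ
  g = (g₁ ⊕ g₂) ⊕ (g₃ ⊕ g₄)
  reassociate : g ⊕ r ≡ g₁ ⊕ (g₂ ⊕ (g₃ ⊕ (g₄ ⊕ r)))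
  reassociate = begin
    ((g₁ ⊕ g₂) ⊕ (g₃ ⊕ g₄)) ⊕ r     ≡⟨ ⊕-assoc (g₁ ⊕ g₂) _ r ⟩
    (g₁ ⊕ g₂) ⊕ ((g₃ ⊕ g₄) ⊕ r)     ≡⟨ ⊕-assoc g₁ g₂ _ ⟩
    g₁ ⊕ (g₂ ⊕ ((g₃ ⊕ g₄) ⊕ r))     ≡⟨ cong (λ t → g₁ ⊕ (g₂ ⊕ t)) (⊕-assoc g₃ g₄ r) ⟩
    g₁ ⊕ (g₂ ⊕ (g₃ ⊕ (g₄ ⊕ r)))     ∎

-- Residue classes and the finite check

-- The thirteen classes of residues m ∈ [1, 12c] on which t is constant: K v π collects the residues
-- with t m = v and m % 2 = π in one segment (2ck, 2c(k+1)] of the definition of t, except that the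
-- residue 4c+1 forms K11 by itself (so K51 starts at 4c+3).
data Class : Set where
  K01 K10 K11 K21 K20 K30 K31 K40 K41 K51 K50 K61 K70 : Class

allClasses : List Class
allClasses = K01 ∷ K10 ∷ K11 ∷ K21 ∷ K20 ∷ K30 ∷ K31 ∷ K40 ∷ K41 ∷ K51 ∷ K50 ∷ K61 ∷ K70 ∷ []

∈-allClasses : ∀ κ → κ ∈ allClasses
∈-allClasses K01 = here refl
∈-allClasses K10 = there (here refl)
∈-allClasses K11 = there (there (here refl))
∈-allClasses K21 = there (there (there (here refl)))
∈-allClasses K20 = there (there (there (there (here refl))))
∈-allClasses K30 = there (there (there (there (there (here refl)))))
∈-allClasses K31 = there (there (there (there (there (there (here refl))))))
∈-allClasses K40 = there (there (there (there (there (there (there (here refl)))))))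
∈-allClasses K41 = there (there (there (there (there (there (there (there (here refl))))))))
∈-allClasses K51 = there (there (there (there (there (there (there (there (there (here refl)))))))))
∈-allClasses K50 = there (there (there (there (there (there (there (there (there (there (here refl))))))))))
∈-allClasses K61 = there (there (there (there (there (there (there (there (there (there (there (here refl)))))))))))
∈-allClasses K70 = there (there (there (there (there (there (there (there (there (there (there (there (here refl))))))))))))

decide-for-all-classes : ∀ {P : Class → Set} (P? : ∀ κ → Dec (P κ)) {_ : True (all? P? allClasses)} → ∀ κ → P κ
decide-for-all-classes P? {ok} κ = lookup (toWitness ok) (∈-allClasses κ)

Profile : Set
Profile = ℕ × ℕ × ℕ

value segments offset weight : Profile → ℕ
value    (v , _ , _) = v
segments (_ , k , _) = k
offset   (_ , _ , o) = o
weight p = offset p + 4 * segments p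

_⊙_ : Profile → Profile → Profile
(v , k , o) ⊙ (v′ , k′ , o′) = v ⊕ v′ , k + k′ , o + o′

-- The value of a class, the index k of its segment and the offset o of its least residue o + 2ck.
profile : Class → Profile
profile K01 = 0 , 0 , 1
profile K10 = 1 , 0 , 2
profile K11 = 1 , 2 , 1
profile K21 = 2 , 1 , 1
profile K20 = 2 , 3 , 2
profile K30 = 3 , 1 , 2
profile K31 = 3 , 3 , 1
profile K40 = 4 , 2 , 2
profile K41 = 4 , 4 , 1
profile K51 = 5 , 2 , 3
profile K50 = 5 , 4 , 2
profile K61 = 6 , 5 , 1
profile K70 = 7 , 5 , 2

fourProfile : Class → Class → Class → Class → Profile
fourProfile κ₁ κ₂ κ₃ κ₄ = (profile κ₁ ⊙ profile κ₂) ⊙ (profile κ₃ ⊙ profile κ₄)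

value<8 : ∀ κ → value (profile κ) < 8
value<8 = decide-for-all-classes (λ κ → value (profile κ) <? 8)

value-⊙<8 : ∀ p p′ → value p < 8 → value p′ < 8 → value (p ⊙ p′) < 8
value-⊙<8 (_ , _ , _) (_ , _ , _) = ⊕-<-2^ 3

fourProfile-value<8 : ∀ κ₁ κ₂ κ₃ κ₄ → value (fourProfile κ₁ κ₂ κ₃ κ₄) < 8
fourProfile-value<8 κ₁ κ₂ κ₃ κ₄ = value-⊙<8 (profile κ₁ ⊙ profile κ₂) (profile κ₃ ⊙ profile κ₄)
  (value-⊙<8 (profile κ₁) (profile κ₂) (value<8 κ₁) (value<8 κ₂))
  (value-⊙<8 (profile κ₃) (profile κ₄) (value<8 κ₃) (value<8 κ₄))

octets-⊙ : ∀ p p′ q r → value p < 8 → value p′ < 8 →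
  (8 * q + value p) ⊕ (8 * r + value p′) ≡ 8 * (q ⊕ r) + value (p ⊙ p′)
octets-⊙ (_ , _ , _) (_ , _ , _) q r = ⊕-octets q r

nim-of-four : ∀ Q₁ Q₂ Q₃ Q₄ κ₁ κ₂ κ₃ κ₄ →
  ((8 * Q₁ + value (profile κ₁)) ⊕ (8 * Q₂ + value (profile κ₂)))
    ⊕ ((8 * Q₃ + value (profile κ₃)) ⊕ (8 * Q₄ + value (profile κ₄)))
  ≡ 8 * ((Q₁ ⊕ Q₂) ⊕ (Q₃ ⊕ Q₄)) + value (fourProfile κ₁ κ₂ κ₃ κ₄)
nim-of-four Q₁ Q₂ Q₃ Q₄ κ₁ κ₂ κ₃ κ₄ = begin
  ((8 * Q₁ + value p₁) ⊕ (8 * Q₂ + value p₂)) ⊕ ((8 * Q₃ + value p₃) ⊕ (8 * Q₄ + value p₄))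
    ≡⟨ cong₂ _⊕_ (octets-⊙ p₁ p₂ Q₁ Q₂ (value<8 κ₁) (value<8 κ₂))
                 (octets-⊙ p₃ p₄ Q₃ Q₄ (value<8 κ₃) (value<8 κ₄)) ⟩
  (8 * (Q₁ ⊕ Q₂) + value (p₁ ⊙ p₂)) ⊕ (8 * (Q₃ ⊕ Q₄) + value (p₃ ⊙ p₄))
    ≡⟨ octets-⊙ (p₁ ⊙ p₂) (p₃ ⊙ p₄) (Q₁ ⊕ Q₂) (Q₃ ⊕ Q₄)
         (value-⊙<8 p₁ p₂ (value<8 κ₁) (value<8 κ₂)) (value-⊙<8 p₃ p₄ (value<8 κ₃) (value<8 κ₄)) ⟩
  8 * ((Q₁ ⊕ Q₂) ⊕ (Q₃ ⊕ Q₄)) + value ((p₁ ⊙ p₂) ⊙ (p₃ ⊙ p₄)) ∎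
  where
  open ≡-Reasoning
  p₁ p₂ p₃ p₄ : Profile
  p₁ = profile κ₁
  p₂ = profile κ₂
  p₃ = profile κ₃
  p₄ = profile κ₄

-- For a value w and a parity π: a pair of classes of least weight whose values XOR to w and whose
-- offsets add up to π modulo 2.
cheapestPair : ℕ → ℕ → Class × Class
cheapestPair 0 0 = K01 , K01
cheapestPair 0 _ = K10 , K11
cheapestPair 1 0 = K01 , K11
cheapestPair 1 _ = K01 , K10
cheapestPair 2 0 = K01 , K21
cheapestPair 2 _ = K01 , K20
cheapestPair 3 0 = K01 , K31
cheapestPair 3 _ = K01 , K30
cheapestPair 4 0 = K01 , K41
cheapestPair 4 _ = K01 , K40
cheapestPair 5 0 = K01 , K51
cheapestPair 5 _ = K01 , K50
cheapestPair 6 0 = K01 , K61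
cheapestPair 6 _ = K21 , K40
cheapestPair 7 0 = K21 , K51
cheapestPair 7 _ = K01 , K70
cheapestPair _ _ = K01 , K01

repairPair : Profile → Class × Class
repairPair p = cheapestPair (value p ⊕ 1) ((offset p + 1) % 2)

pairProfile : Class × Class → Profile
pairProfile (λ₁ , λ₂) = profile λ₁ ⊙ profile λ₂

-- weight p is the base of p for c = 2. Bases grow with c at the rate 2 · segments, so these
-- conditions make base q + 2 ≤ base p + 1, with even difference, for every c ≥ 2 (see repair).
Fits : Profile → Profile → Set
Fits p q = value q ≡ value p ⊕ 1 × segments q ≤ segments p × weight q + 2 ≤ weight p + 1
         × (weight p + 1 ∸ (weight q + 2)) % 2 ≡ 0

fits? : ∀ p q → Dec (Fits p q)
fits? p q = value q ≟ value p ⊕ 1 ×-dec segments q ≤? segments p ×-dec weight q + 2 ≤? weight p + 1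
         ×-dec (weight p + 1 ∸ (weight q + 2)) % 2 ≟ 0

Repairable : Profile → Set
Repairable p = Fits p (pairProfile (repairPair p))

repairable? : ∀ p → Dec (Repairable p)
repairable? p = fits? p (pairProfile (repairPair p))

_≟ₚ_ : DecidableEquality Profile
_≟ₚ_ = ≡-dec _≟_ (≡-dec _≟_ _≟_)

-- Repairability of four classes only depends on the profiles of the first two and of the last two;
-- there are 65 distinct such pair profiles, so deciding all pairs of them replaces 13⁴ cases by 65².
pairProfiles : List Profile
pairProfiles = deduplicate _≟ₚ_ (cartesianProductWith _⊙_ (map profile allClasses) (map profile allClasses))

pair∈pairProfiles : ∀ κ₁ κ₂ → profile κ₁ ⊙ profile κ₂ ∈ pairProfiles
pair∈pairProfiles κ₁ κ₂ = ∈-deduplicate⁺ _≟ₚ_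
  (∈-cartesianProductWith⁺ _⊙_ (∈-map⁺ profile (∈-allClasses κ₁)) (∈-map⁺ profile (∈-allClasses κ₂)))

all-repairable : All (λ x → All (λ y → Repairable (x ⊙ y)) pairProfiles) pairProfiles
all-repairable = toWitness {a? = all? (λ x → all? (λ y → repairable? (x ⊙ y)) pairProfiles) pairProfiles} _

repairable : ∀ κ₁ κ₂ κ₃ κ₄ → Repairable (fourProfile κ₁ κ₂ κ₃ κ₄)
repairable κ₁ κ₂ κ₃ κ₄ = lookup (lookup all-repairable (pair∈pairProfiles κ₁ κ₂)) (pair∈pairProfiles κ₃ κ₄)

nim-after-repair : ∀ Q₁ Q₂ Q₃ Q₄ κ₁ κ₂ κ₃ κ₄ →
  let λ₁ , λ₂ = repairPair (fourProfile κ₁ κ₂ κ₃ κ₄) in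
  value (profile λ₁) ⊕ (8 * ((Q₁ ⊕ Q₂) ⊕ (Q₃ ⊕ Q₄)) + value (profile λ₂))
    ≡ (((8 * Q₁ + value (profile κ₁)) ⊕ (8 * Q₂ + value (profile κ₂)))
       ⊕ ((8 * Q₃ + value (profile κ₃)) ⊕ (8 * Q₄ + value (profile κ₄)))) ⊕ 1
nim-after-repair Q₁ Q₂ Q₃ Q₄ κ₁ κ₂ κ₃ κ₄ = begin
  (8 * 0 + value (profile λ₁)) ⊕ (8 * Q + value (profile λ₂))
    ≡⟨ octets-⊙ (profile λ₁) (profile λ₂) 0 Q (value<8 λ₁) (value<8 λ₂) ⟩
  8 * (0 ⊕ Q) + value (profile λ₁ ⊙ profile λ₂)
    ≡⟨ cong₂ (λ x y → 8 * x + y) (trans (⊕-identityˡ Q) (sym (⊕-identityʳ Q)))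
                                  (proj₁ (repairable κ₁ κ₂ κ₃ κ₄)) ⟩
  8 * (Q ⊕ 0) + (value p ⊕ 1)
    ≡⟨ ⊕-octets Q 0 (fourProfile-value<8 κ₁ κ₂ κ₃ κ₄) (s≤s (s≤s z≤n)) ⟨
  (8 * Q + value p) ⊕ 1
    ≡⟨ cong (_⊕ 1) (nim-of-four Q₁ Q₂ Q₃ Q₄ κ₁ κ₂ κ₃ κ₄) ⟨
  (((8 * Q₁ + value (profile κ₁)) ⊕ (8 * Q₂ + value (profile κ₂)))
    ⊕ ((8 * Q₃ + value (profile κ₃)) ⊕ (8 * Q₄ + value (profile κ₄)))) ⊕ 1 ∎
  where
  open ≡-Reasoning
  p : Profile
  p = fourProfile κ₁ κ₂ κ₃ κ₄
  λ₁ λ₂ : Class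
  λ₁ = proj₁ (repairPair p)
  λ₂ = proj₂ (repairPair p)
  Q : ℕ
  Q = (Q₁ ⊕ Q₂) ⊕ (Q₃ ⊕ Q₄)

-- The sequence s_c

segment-bounds : ∀ c k {o} → 1 ≤ o → o ≤ 2 * c →
  2 * k * c < o + 2 * (k * c) × o + 2 * (k * c) ≤ 2 * suc k * c
segment-bounds c k {o} 1≤o o≤2c =
  subst (_< o + 2 * (k * c)) (sym (*-assoc 2 k c)) (+-monoˡ-≤ (2 * (k * c)) 1≤o) ,
  subst (o + 2 * (k * c) ≤_) (next-segment c k) (+-monoˡ-≤ (2 * (k * c)) o≤2c)
  where
  next-segment : ∀ c k → 2 * c + 2 * (k * c) ≡ 2 * suc k * c
  next-segment = solve-∀

block-decomposition : ∀ N .{{_ : NonZero N}} {h} → 1 ≤ h → Σ ℕ λ Q → Σ ℕ λ m → h ≡ N * Q + m × 1 ≤ m × m ≤ N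
block-decomposition N {suc h} _ = h / N , suc (h % N) , h≡ , s≤s z≤n , m%n<n h N
  where
  h≡ : suc h ≡ N * (h / N) + suc (h % N)
  h≡ = begin
    suc h                      ≡⟨ cong suc (m≡m%n+[m/n]*n h N) ⟩
    suc (h % N + h / N * N)    ≡⟨ cong suc (+-comm (h % N) _) ⟩
    suc (h / N * N + h % N)    ≡⟨ +-suc (h / N * N) (h % N) ⟨
    h / N * N + suc (h % N)    ≡⟨ cong (_+ suc (h % N)) (*-comm (h / N) N) ⟩
    N * (h / N) + suc (h % N)  ∎
    where open ≡-Reasoning

oddEven-odd : ∀ m a b → m % 2 ≡ 1 → oddEven m a b ≡ a
oddEven-odd m a b m-odd rewrite m-odd = refl

oddEven-even : ∀ m a b → m % 2 ≡ 0 → oddEven m a b ≡ b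
oddEven-even m a b m-even rewrite m-even = refl

oddEven-+2* : ∀ o n a b → oddEven (o + 2 * n) a b ≡ oddEven o a b
oddEven-+2* o n a b = cong (λ r → if r ≡ᵇ 1 then a else b) ([m+2n]%2≡m%2 o n)

summands≤ : ∀ h₁ h₂ h₃ h₄ S {n} → h₁ + (h₂ + (h₃ + (h₄ + S))) ≡ n → h₁ ≤ n × h₂ ≤ n × h₃ ≤ n × h₄ ≤ n
summands≤ h₁ h₂ h₃ h₄ S refl =
  m≤m+n h₁ _ ,
  ≤-trans (m≤m+n h₂ _) (m≤n+m _ h₁) ,
  ≤-trans (≤-trans (m≤m+n h₃ _) (m≤n+m _ h₂)) (m≤n+m _ h₁) ,
  ≤-trans (≤-trans (≤-trans (m≤m+n h₄ S) (m≤n+m _ h₃)) (m≤n+m _ h₂)) (m≤n+m _ h₁)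

replaced≤ : ∀ a b z S {n} → 1 ≤ a → a + (a + (b + (z + S))) ≡ suc n → b ≤ n × z ≤ n
replaced≤ (suc a′) b z S _ refl =
  ≤-trans (m≤m+n b _) (≤-trans (m≤n+m _ (suc a′)) (m≤n+m _ a′)) ,
  ≤-trans (≤-trans (m≤m+n z S) (m≤n+m _ b)) (≤-trans (m≤n+m _ (suc a′)) (m≤n+m _ a′))

sum-of-heaps : ∀ c Q₁ Q₂ Q₃ Q₄ B₁ B₂ B₃ B₄ e₁ e₂ e₃ e₄ S →
  suc ((12 * c * Q₁ + (B₁ + 2 * e₁)) + ((12 * c * Q₂ + (B₂ + 2 * e₂))
    + ((12 * c * Q₃ + (B₃ + 2 * e₃)) + ((12 * c * Q₄ + (B₄ + 2 * e₄)) + S))))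
  ≡ 12 * c * ((Q₁ + Q₂) + (Q₃ + Q₄)) + ((B₁ + B₂) + (B₃ + B₄) + 1) + 2 * ((e₁ + e₂) + (e₃ + e₄)) + S
sum-of-heaps = solve-∀

sum-of-replacement : ∀ c F E R Q B₁ B₂ S →
  suc (F + E + 6 * c * R) + (suc (F + E + 6 * c * R) + (B₁ + ((12 * c * Q + B₂) + S)))
  ≡ 12 * c * (Q + R) + ((B₁ + B₂) + 2 * suc F) + 2 * E + S
sum-of-replacement = solve-∀

module _ (d : ℕ) where

  c : ℕ
  c = 2 + d

  -- does (m ≤? n) and does (m ≟ n) reduce to m ≤ᵇ n and m ≡ᵇ n, so dec-true and dec-false
  -- evaluate the guards of t.
  t-≤2c : ∀ {m} → m ≤ 2 * c → t c m ≡ oddEven m 0 1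
  t-≤2c {m} m≤ rewrite dec-true (m ≤? 2 * c) m≤ = refl

  t-≤4c : ∀ {m} → 2 * c < m → m ≤ 4 * c → t c m ≡ oddEven m 2 3
  t-≤4c {m} <m m≤ rewrite dec-false (m ≤? 2 * c) (<⇒≱ <m) | dec-true (m ≤? 4 * c) m≤ = refl

  c-mono : ∀ {j k} → j ≤ k → j * c ≤ k * c
  c-mono = *-monoˡ-≤ c

  4c<4c+1 : 4 * c < 4 * c + 1
  4c<4c+1 = m<m+n (4 * c) (s≤s z≤n)

  4c+1≤6c : 4 * c + 1 ≤ 6 * c
  4c+1≤6c = ≤-trans (+-monoʳ-≤ (4 * c) (s≤s z≤n)) (≤-reflexive (sym (*-distribʳ-+ c 4 2)))

  ≰-below : ∀ j k {m} {_ : T (j ≤ᵇ k)} → k * c < m → ¬ m ≤ j * c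
  ≰-below j k {_} {j≤k} <m = <⇒≱ (≤-<-trans (c-mono (≤ᵇ⇒≤ j k j≤k)) <m)

  ≢4c+1-above : ∀ k {m} {_ : T (6 ≤ᵇ k)} → k * c < m → m ≢ 4 * c + 1
  ≢4c+1-above k {_} {6≤k} <m = >⇒≢ (≤-<-trans (≤-trans 4c+1≤6c (c-mono (≤ᵇ⇒≤ 6 k 6≤k))) <m)

  t-4c+1 : t c (4 * c + 1) ≡ 1
  t-4c+1 rewrite dec-false (4 * c + 1 ≤? 2 * c) (≰-below 2 4 4c<4c+1)
               | dec-false (4 * c + 1 ≤? 4 * c) (<⇒≱ 4c<4c+1)
               | dec-true (4 * c + 1 ≟ 4 * c + 1) refl = refl

  t-≤6c : ∀ {m} → 4 * c < m → m ≢ 4 * c + 1 → m ≤ 6 * c → t c m ≡ oddEven m 5 4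
  t-≤6c {m} <m m≢ m≤ rewrite dec-false (m ≤? 2 * c) (≰-below 2 4 <m)
                           | dec-false (m ≤? 4 * c) (<⇒≱ <m) | dec-false (m ≟ 4 * c + 1) m≢
                           | dec-true (m ≤? 6 * c) m≤ = refl

  t-≤8c : ∀ {m} → 6 * c < m → m ≤ 8 * c → t c m ≡ oddEven m 3 2
  t-≤8c {m} <m m≤ rewrite dec-false (m ≤? 2 * c) (≰-below 2 6 <m)
                        | dec-false (m ≤? 4 * c) (≰-below 4 6 <m)
                        | dec-false (m ≟ 4 * c + 1) (≢4c+1-above 6 <m)
                        | dec-false (m ≤? 6 * c) (<⇒≱ <m) | dec-true (m ≤? 8 * c) m≤ = refl

  t-≤10c : ∀ {m} → 8 * c < m → m ≤ 10 * c → t c m ≡ oddEven m 4 5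
  t-≤10c {m} <m m≤ rewrite dec-false (m ≤? 2 * c) (≰-below 2 8 <m)
                         | dec-false (m ≤? 4 * c) (≰-below 4 8 <m)
                         | dec-false (m ≟ 4 * c + 1) (≢4c+1-above 8 <m)
                         | dec-false (m ≤? 6 * c) (≰-below 6 8 <m)
                         | dec-false (m ≤? 8 * c) (<⇒≱ <m) | dec-true (m ≤? 10 * c) m≤ = refl

  t->10c : ∀ {m} → 10 * c < m → t c m ≡ oddEven m 6 7
  t->10c {m} <m rewrite dec-false (m ≤? 2 * c) (≰-below 2 10 <m)
                      | dec-false (m ≤? 4 * c) (≰-below 4 10 <m)
                      | dec-false (m ≟ 4 * c + 1) (≢4c+1-above 10 <m)
                      | dec-false (m ≤? 6 * c) (≰-below 6 10 <m)
                      | dec-false (m ≤? 8 * c) (≰-below 8 10 <m)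
                      | dec-false (m ≤? 10 * c) (<⇒≱ <m) = refl

  base : Profile → ℕ
  base p = offset p + 2 * (segments p * c)

  3≤2c : 3 ≤ 2 * c
  3≤2c = ≤-trans (n≤1+n 3) (*-monoʳ-≤ 2 (s≤s (s≤s z≤n)))

  offset-range : ∀ κ → 1 ≤ offset (profile κ) × offset (profile κ) ≤ 3
  offset-range = decide-for-all-classes (λ κ → 1 ≤? offset (profile κ) ×-dec offset (profile κ) ≤? 3)

  offset≤2c : ∀ κ → offset (profile κ) ≤ 2 * c
  offset≤2c κ = ≤-trans (proj₂ (offset-range κ)) 3≤2c

  segment-start<base : ∀ κ → 2 * segments (profile κ) * c < base (profile κ)
  segment-start<base κ = proj₁ (segment-bounds c (segments (profile κ)) (proj₁ (offset-range κ)) (offset≤2c κ))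

  base≤segment-end : ∀ κ → base (profile κ) ≤ 2 * suc (segments (profile κ)) * c
  base≤segment-end κ = proj₂ (segment-bounds c (segments (profile κ)) (proj₁ (offset-range κ)) (offset≤2c κ))

  4c+1≡1+2[2c] : 4 * c + 1 ≡ 1 + 2 * (2 * c)
  4c+1≡1+2[2c] = trans (+-comm (4 * c) 1) (cong suc (*-assoc 2 2 c))

  ≢4c+1 : ∀ {m} → 1 + 2 * (2 * c) < m → m ≢ 4 * c + 1
  ≢4c+1 {m} lt = >⇒≢ (subst (_< m) (sym 4c+1≡1+2[2c]) lt)

  t-base : ∀ κ → t c (base (profile κ)) ≡ value (profile κ)
  t-base K01 = t-≤2c (base≤segment-end K01)
  t-base K10 = t-≤2c (base≤segment-end K10)
  t-base K11 = subst (λ m → t c m ≡ 1) 4c+1≡1+2[2c] t-4c+1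
  t-base K21 = trans (t-≤4c (segment-start<base K21) (base≤segment-end K21))
                     (oddEven-+2* 1 (1 * c) 2 3)
  t-base K30 = trans (t-≤4c (segment-start<base K30) (base≤segment-end K30))
                     (oddEven-+2* 2 (1 * c) 2 3)
  t-base K40 = trans (t-≤6c (segment-start<base K40) (≢4c+1 ≤-refl) (base≤segment-end K40))
                     (oddEven-+2* 2 (2 * c) 5 4)
  t-base K51 = trans (t-≤6c (segment-start<base K51) (≢4c+1 (n≤1+n _)) (base≤segment-end K51))
                     (oddEven-+2* 3 (2 * c) 5 4)
  t-base K31 = trans (t-≤8c (segment-start<base K31) (base≤segment-end K31))
                     (oddEven-+2* 1 (3 * c) 3 2)
  t-base K20 = trans (t-≤8c (segment-start<base K20) (base≤segment-end K20))
                     (oddEven-+2* 2 (3 * c) 3 2)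
  t-base K41 = trans (t-≤10c (segment-start<base K41) (base≤segment-end K41))
                     (oddEven-+2* 1 (4 * c) 4 5)
  t-base K50 = trans (t-≤10c (segment-start<base K50) (base≤segment-end K50))
                     (oddEven-+2* 2 (4 * c) 4 5)
  t-base K61 = trans (t->10c (segment-start<base K61))
                     (oddEven-+2* 1 (5 * c) 6 7)
  t-base K70 = trans (t->10c (segment-start<base K70))
                     (oddEven-+2* 2 (5 * c) 6 7)

  odd-in-segment : ∀ k {m} → 2 * k * c < m → m % 2 ≡ 1 → Σ ℕ λ e → m ≡ (1 + 2 * (k * c)) + 2 * e
  odd-in-segment k {m} above odd =
    same-parity-above (subst (_< m) (*-assoc 2 k c) above) (trans odd (sym ([m+2n]%2≡m%2 1 (k * c))))

  even-in-segment : ∀ k {m} → 2 * k * c < m → m % 2 ≡ 0 → Σ ℕ λ e → m ≡ (2 + 2 * (k * c)) + 2 * e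
  even-in-segment k {m} above even = same-parity-above
    (≤-parity-step (subst (_< m) (*-assoc 2 k c) above) (λ m≡ → 0≢1+n (trans (sym even) (trans m≡ ([m+2n]%2≡m%2 1 (k * c))))))
    (trans even (sym ([m+2n]%2≡m%2 2 (k * c))))

  odd-beyond-4c+1 : ∀ {m} → 4 * c < m → m ≢ 4 * c + 1 → m % 2 ≡ 1 → Σ ℕ λ e → m ≡ (3 + 2 * (2 * c)) + 2 * e
  odd-beyond-4c+1 {m} above m≢ odd = same-parity-above
    (≤-parity-step 2+4c≤m (λ m≡ → 0≢1+n (trans (sym ([m+2n]%2≡m%2 2 (2 * c))) (trans (sym m≡) odd))))
    (trans odd (sym ([m+2n]%2≡m%2 3 (2 * c))))
    where
    2+4c≤m : 2 + 2 * (2 * c) ≤ m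
    2+4c≤m = ≤∧≢⇒< (subst (_< m) (*-assoc 2 2 c) above) (λ eq → m≢ (trans (sym eq) (sym 4c+1≡1+2[2c])))

  record Classified (m : ℕ) : Set where
    constructor classified
    field
      class  : Class
      excess : ℕ
      m≡     : m ≡ base (profile class) + 2 * excess
      t≡     : t c m ≡ value (profile class)

  in-class : ∀ κ {m} → Σ ℕ (λ e → m ≡ base (profile κ) + 2 * e) → t c m ≡ value (profile κ) → Classified m
  in-class κ (e , m≡) t≡ = classified κ e m≡ t≡

  classify : ∀ {m} → 1 ≤ m → Classified m
  classify {m} 1≤m with m ≤? 2 * c | %2-cases m
  ... | yes m≤ | inj₂ odd  = in-class K01 (odd-in-segment 0 1≤m odd)
                               (trans (t-≤2c m≤) (oddEven-odd m 0 1 odd))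
  ... | yes m≤ | inj₁ even = in-class K10 (even-in-segment 0 1≤m even)
                               (trans (t-≤2c m≤) (oddEven-even m 0 1 even))
  ... | no m≰ | parity with ≰⇒> m≰ | m ≤? 4 * c | parity
  ... | 2c<m | yes m≤ | inj₂ odd  = in-class K21 (odd-in-segment 1 2c<m odd)
                                      (trans (t-≤4c 2c<m m≤) (oddEven-odd m 2 3 odd))
  ... | 2c<m | yes m≤ | inj₁ even = in-class K30 (even-in-segment 1 2c<m even)
                                      (trans (t-≤4c 2c<m m≤) (oddEven-even m 2 3 even))
  ... | _ | no m≰′ | _ with ≰⇒> m≰′ | m ≟ 4 * c + 1
  ... | _    | yes refl = in-class K11 (0 , trans 4c+1≡1+2[2c] (sym (+-identityʳ _))) t-4c+1
  ... | 4c<m | no m≢ with m ≤? 6 * c | parity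
  ... | yes m≤ | inj₂ odd  = in-class K51 (odd-beyond-4c+1 4c<m m≢ odd)
                               (trans (t-≤6c 4c<m m≢ m≤) (oddEven-odd m 5 4 odd))
  ... | yes m≤ | inj₁ even = in-class K40 (even-in-segment 2 4c<m even)
                               (trans (t-≤6c 4c<m m≢ m≤) (oddEven-even m 5 4 even))
  ... | no m≰″ | _ with ≰⇒> m≰″ | m ≤? 8 * c | parity
  ... | 6c<m | yes m≤ | inj₂ odd  = in-class K31 (odd-in-segment 3 6c<m odd)
                                      (trans (t-≤8c 6c<m m≤) (oddEven-odd m 3 2 odd))
  ... | 6c<m | yes m≤ | inj₁ even = in-class K20 (even-in-segment 3 6c<m even)
                                      (trans (t-≤8c 6c<m m≤) (oddEven-even m 3 2 even))
  ... | _ | no m≰‴ | _ with ≰⇒> m≰‴ | m ≤? 10 * c | parity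
  ... | 8c<m | yes m≤ | inj₂ odd  = in-class K41 (odd-in-segment 4 8c<m odd)
                                      (trans (t-≤10c 8c<m m≤) (oddEven-odd m 4 5 odd))
  ... | 8c<m | yes m≤ | inj₁ even = in-class K50 (even-in-segment 4 8c<m even)
                                      (trans (t-≤10c 8c<m m≤) (oddEven-even m 4 5 even))
  ... | _ | no m≰⁗ | inj₂ odd  = in-class K61 (odd-in-segment 5 (≰⇒> m≰⁗) odd)
                                   (trans (t->10c (≰⇒> m≰⁗)) (oddEven-odd m 6 7 odd))
  ... | _ | no m≰⁗ | inj₁ even = in-class K70 (even-in-segment 5 (≰⇒> m≰⁗) even)
                                   (trans (t->10c (≰⇒> m≰⁗)) (oddEven-even m 6 7 even))

  s-block : ∀ Q {m} → 1 ≤ m → m ≤ 12 * c → s c (12 * c * Q + m) ≡ 8 * Q + t c m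
  s-block Q {suc m} _ m<12c = begin
    s c (12 * c * Q + suc m)
      ≡⟨⟩
    8 * ((12 * c * Q + suc m ∸ 1) / (12 * c))
      + t c (12 * c * Q + suc m ∸ 12 * c * ((12 * c * Q + suc m ∸ 1) / (12 * c)))
      ≡⟨ cong (λ q → 8 * q + t c (12 * c * Q + suc m ∸ 12 * c * q)) quotient ⟩
    8 * Q + t c (12 * c * Q + suc m ∸ 12 * c * Q)
      ≡⟨ cong (λ x → 8 * Q + t c x) (m+n∸m≡n (12 * c * Q) (suc m)) ⟩
    8 * Q + t c (suc m)
      ∎
    where
    open ≡-Reasoning
    quotient : (12 * c * Q + suc m ∸ 1) / (12 * c) ≡ Q
    quotient = begin
      (12 * c * Q + suc m ∸ 1) / (12 * c) ≡⟨ cong (λ x → (x ∸ 1) / (12 * c)) (+-suc (12 * c * Q) m) ⟩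
      (12 * c * Q + m) / (12 * c)         ≡⟨ cong (λ x → (x + m) / (12 * c)) (*-comm (12 * c) Q) ⟩
      (Q * (12 * c) + m) / (12 * c)       ≡⟨ +-distrib-/-∣ˡ m (divides-refl Q) ⟩
      Q * (12 * c) / (12 * c) + m / (12 * c) ≡⟨ cong₂ _+_ (m*n/n≡m Q (12 * c)) (m<n⇒m/n≡0 m<12c) ⟩
      Q + 0                               ≡⟨ +-identityʳ Q ⟩
      Q                                   ∎

  base-⊙ : ∀ p q → base (p ⊙ q) ≡ base p + base q
  base-⊙ (_ , k , o) (_ , k′ , o′) = regroup o o′ k k′ c
    where
    regroup : ∀ o o′ k k′ c → o + o′ + 2 * ((k + k′) * c) ≡ (o + 2 * (k * c)) + (o′ + 2 * (k′ * c))
    regroup = solve-∀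

  base≡weight+2sd : ∀ p → base p ≡ weight p + 2 * (segments p * d)
  base≡weight+2sd (_ , k , o) = regroup o k d
    where
    regroup : ∀ o k d → o + 2 * (k * (2 + d)) ≡ o + 4 * k + 2 * (k * d)
    regroup = solve-∀

  repair : ∀ p q → Fits p q → Σ ℕ λ F → base p + 1 ≡ base q + 2 * suc F
  repair p q (_ , sq≤sp , wq+2≤wp+1 , D-even) = w + u * d , (begin
    base p + 1                                           ≡⟨ cong (_+ 1) (base≡weight+2sd p) ⟩
    weight p + 2 * (segments p * d) + 1                  ≡⟨ +-comm-1 (weight p) _ ⟩
    (weight p + 1) + 2 * (segments p * d)                ≡⟨ cong₂ (λ x y → x + 2 * (y * d)) (sym weights) (sym segs) ⟩
    (weight q + 2 + D) + 2 * ((segments q + u) * d)      ≡⟨ cong (λ x → weight q + 2 + x + 2 * ((segments q + u) * d)) D≡2w ⟩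
    (weight q + 2 + 2 * w) + 2 * ((segments q + u) * d)  ≡⟨ regroup (weight q) w (segments q) u d ⟩
    weight q + 2 * (segments q * d) + 2 * suc (w + u * d) ≡⟨ cong (_+ 2 * suc (w + u * d)) (base≡weight+2sd q) ⟨
    base q + 2 * suc (w + u * d)                         ∎)
    where
    open ≡-Reasoning
    u D w : ℕ
    u = segments p ∸ segments q
    D = weight p + 1 ∸ (weight q + 2)
    w = D / 2
    segs : segments q + u ≡ segments p
    segs = m+[n∸m]≡n sq≤sp
    weights : weight q + 2 + D ≡ weight p + 1
    weights = m+[n∸m]≡n wq+2≤wp+1
    D≡2w : D ≡ 2 * w
    D≡2w = trans (n≡n%2+2*[n/2] D) (cong (_+ 2 * w) D-even)
    +-comm-1 : ∀ x y → x + y + 1 ≡ (x + 1) + y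
    +-comm-1 = solve-∀
    regroup : ∀ W w s u d → (W + 2 + 2 * w) + 2 * ((s + u) * d) ≡ W + 2 * (s * d) + 2 * suc (w + u * d)
    regroup = solve-∀

  segments≤5 : ∀ κ → segments (profile κ) ≤ 5
  segments≤5 = decide-for-all-classes (λ κ → segments (profile κ) ≤? 5)

  1≤base : ∀ κ → 1 ≤ base (profile κ)
  1≤base κ = ≤-trans (proj₁ (offset-range κ)) (m≤m+n _ _)

  base≤12c : ∀ κ → base (profile κ) ≤ 12 * c
  base≤12c κ = ≤-trans (base≤segment-end κ) (c-mono (*-monoʳ-≤ 2 (s≤s (segments≤5 κ))))

  𝒢 : ℕ → ℕ
  𝒢 = G (cutSet c)

  Agrees : ℕ → Set
  Agrees n = ∀ m → 1 ≤ m → m ≤ n → 𝒢 m ≡ s c m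

  record Heap (h : ℕ) : Set where
    field
      block  : ℕ
      class  : Class
      excess : ℕ
      size≡  : h ≡ 12 * c * block + (base (profile class) + 2 * excess)
      nim≡   : 𝒢 h ≡ 8 * block + value (profile class)

  heap : ∀ {n} → Agrees n → ∀ {h} → 1 ≤ h → h ≤ n → Heap h
  heap agrees {h} 1≤h h≤n with block-decomposition (12 * c) 1≤h
  ... | Q , m , h≡ , 1≤m , m≤12c with classify 1≤m
  ... | classified κ e m≡ t≡ = record
    { block = Q ; class = κ ; excess = e
    ; size≡ = trans h≡ (cong (12 * c * Q +_) m≡)
    ; nim≡  = begin
        𝒢 h                    ≡⟨ agrees h 1≤h h≤n ⟩
        s c h                  ≡⟨ cong (s c) h≡ ⟩
        s c (12 * c * Q + m)   ≡⟨ s-block Q 1≤m m≤12c ⟩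
        8 * Q + t c m          ≡⟨ cong (8 * Q +_) t≡ ⟩
        8 * Q + value (profile κ) ∎
    }
    where open ≡-Reasoning

  nim-at-base : ∀ {n} → Agrees n → ∀ {h} Q κ → h ≡ 12 * c * Q + base (profile κ) → h ≤ n →
    𝒢 h ≡ 8 * Q + value (profile κ)
  nim-at-base agrees {h} Q κ h≡ h≤n = begin
    𝒢 h                                   ≡⟨ agrees h 1≤h h≤n ⟩
    s c h                                 ≡⟨ cong (s c) h≡ ⟩
    s c (12 * c * Q + base (profile κ))   ≡⟨ s-block Q (1≤base κ) (base≤12c κ) ⟩
    8 * Q + t c (base (profile κ))        ≡⟨ cong (8 * Q +_) (t-base κ) ⟩
    8 * Q + value (profile κ)             ∎
    where
    open ≡-Reasoning
    1≤h : 1 ≤ h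
    1≤h = subst (1 ≤_) (sym h≡) (≤-trans (1≤base κ) (m≤n+m (base (profile κ)) (12 * c * Q)))

  Replacement : ℕ → ℕ → ℕ → ℕ → ℕ → ℕ → Set
  Replacement n S h₁ h₂ h₃ h₄ = Σ ℕ λ a → Σ ℕ λ b → Σ ℕ λ z → 1 ≤ a × 1 ≤ b × 1 ≤ z
    × a + (a + (b + (z + S))) ≡ suc n × 𝒢 b ⊕ 𝒢 z ≡ ((𝒢 h₁ ⊕ 𝒢 h₂) ⊕ (𝒢 h₃ ⊕ 𝒢 h₄)) ⊕ 1

  module Replace {h₁ h₂ h₃ h₄} (H₁ : Heap h₁) (H₂ : Heap h₂) (H₃ : Heap h₃) (H₄ : Heap h₄) where
    open Heap H₁ renaming (block to Q₁; class to κ₁; excess to e₁; size≡ to h₁≡; nim≡ to 𝒢h₁≡)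
    open Heap H₂ renaming (block to Q₂; class to κ₂; excess to e₂; size≡ to h₂≡; nim≡ to 𝒢h₂≡)
    open Heap H₃ renaming (block to Q₃; class to κ₃; excess to e₃; size≡ to h₃≡; nim≡ to 𝒢h₃≡)
    open Heap H₄ renaming (block to Q₄; class to κ₄; excess to e₄; size≡ to h₄≡; nim≡ to 𝒢h₄≡)

    p : Profile
    p = fourProfile κ₁ κ₂ κ₃ κ₄

    λ₁ λ₂ : Class
    λ₁ = proj₁ (repairPair p)
    λ₂ = proj₂ (repairPair p)

    Q : ℕ
    Q = (Q₁ ⊕ Q₂) ⊕ (Q₃ ⊕ Q₄)

    b z : ℕ
    b = base (profile λ₁)
    z = 12 * c * Q + base (profile λ₂)

    1≤b : 1 ≤ b
    1≤b = 1≤base λ₁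

    1≤z : 1 ≤ z
    1≤z = ≤-trans (1≤base λ₂) (m≤n+m _ (12 * c * Q))

    -- The two equal heaps absorb the loss 12c·R of the high parts, the excesses 2E and the
    -- surplus 2(F + 1) of the old bases over the new ones.
    sizes : ∀ S → Σ ℕ λ a → 1 ≤ a × a + (a + (b + (z + S))) ≡ suc (h₁ + (h₂ + (h₃ + (h₄ + S))))
    sizes S = suc (F + E + 6 * c * R) , s≤s z≤n , (begin
      suc (F + E + 6 * c * R) + (suc (F + E + 6 * c * R) + (b + (z + S)))
        ≡⟨ sum-of-replacement c F E R Q b (base (profile λ₂)) S ⟩
      12 * c * (Q + R) + ((b + base (profile λ₂)) + 2 * suc F) + 2 * E + S
        ≡⟨ cong₂ (λ x y → 12 * c * x + y + 2 * E + S) (m+[n∸m]≡n Q≤ΣQ) base-repaired ⟩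
      12 * c * ΣQ + ((base p₁ + base p₂) + (base p₃ + base p₄) + 1) + 2 * E + S
        ≡⟨ sum-of-heaps c Q₁ Q₂ Q₃ Q₄ (base p₁) (base p₂) (base p₃) (base p₄) e₁ e₂ e₃ e₄ S ⟨
      suc ((12 * c * Q₁ + (base p₁ + 2 * e₁)) + ((12 * c * Q₂ + (base p₂ + 2 * e₂))
        + ((12 * c * Q₃ + (base p₃ + 2 * e₃)) + ((12 * c * Q₄ + (base p₄ + 2 * e₄)) + S))))
        ≡⟨ cong suc (cong₂ _+_ h₁≡ (cong₂ _+_ h₂≡ (cong₂ _+_ h₃≡ (cong (_+ S) h₄≡)))) ⟨
      suc (h₁ + (h₂ + (h₃ + (h₄ + S)))) ∎)
      where
      open ≡-Reasoning
      p₁ p₂ p₃ p₄ : Profile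
      p₁ = profile κ₁
      p₂ = profile κ₂
      p₃ = profile κ₃
      p₄ = profile κ₄
      repaired : Σ ℕ λ F → base p + 1 ≡ base (profile λ₁ ⊙ profile λ₂) + 2 * suc F
      repaired = repair p (profile λ₁ ⊙ profile λ₂) (repairable κ₁ κ₂ κ₃ κ₄)
      F ΣQ R E : ℕ
      F = proj₁ repaired
      ΣQ = (Q₁ + Q₂) + (Q₃ + Q₄)
      R = ΣQ ∸ Q
      E = (e₁ + e₂) + (e₃ + e₄)
      Q≤ΣQ : Q ≤ ΣQ
      Q≤ΣQ = ≤-trans (⊕≤+ (Q₁ ⊕ Q₂) (Q₃ ⊕ Q₄)) (+-mono-≤ (⊕≤+ Q₁ Q₂) (⊕≤+ Q₃ Q₄))
      base-p : base p ≡ (base p₁ + base p₂) + (base p₃ + base p₄)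
      base-p = trans (base-⊙ (p₁ ⊙ p₂) (p₃ ⊙ p₄)) (cong₂ _+_ (base-⊙ p₁ p₂) (base-⊙ p₃ p₄))
      base-repaired : (b + base (profile λ₂)) + 2 * suc F ≡ (base p₁ + base p₂) + (base p₃ + base p₄) + 1
      base-repaired = begin
        (b + base (profile λ₂)) + 2 * suc F   ≡⟨ cong (_+ 2 * suc F) (base-⊙ (profile λ₁) (profile λ₂)) ⟨
        base (profile λ₁ ⊙ profile λ₂) + 2 * suc F ≡⟨ proj₂ repaired ⟨
        base p + 1                            ≡⟨ cong (_+ 1) base-p ⟩
        (base p₁ + base p₂) + (base p₃ + base p₄) + 1 ∎

    nims : ∀ {n} → Agrees n → b ≤ n → z ≤ n → 𝒢 b ⊕ 𝒢 z ≡ ((𝒢 h₁ ⊕ 𝒢 h₂) ⊕ (𝒢 h₃ ⊕ 𝒢 h₄)) ⊕ 1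
    nims agrees b≤ z≤ = begin
      𝒢 b ⊕ 𝒢 z
        ≡⟨ cong₂ _⊕_ (nim-at-base agrees 0 λ₁ (cong (_+ b) (sym (*-zeroʳ (12 * c)))) b≤)
                     (nim-at-base agrees Q λ₂ refl z≤) ⟩
      value (profile λ₁) ⊕ (8 * Q + value (profile λ₂))
        ≡⟨ nim-after-repair Q₁ Q₂ Q₃ Q₄ κ₁ κ₂ κ₃ κ₄ ⟩
      (((8 * Q₁ + value (profile κ₁)) ⊕ (8 * Q₂ + value (profile κ₂)))
        ⊕ ((8 * Q₃ + value (profile κ₃)) ⊕ (8 * Q₄ + value (profile κ₄)))) ⊕ 1
        ≡⟨ cong (_⊕ 1) (cong₂ _⊕_ (cong₂ _⊕_ 𝒢h₁≡ 𝒢h₂≡) (cong₂ _⊕_ 𝒢h₃≡ 𝒢h₄≡)) ⟨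
      ((𝒢 h₁ ⊕ 𝒢 h₂) ⊕ (𝒢 h₃ ⊕ 𝒢 h₄)) ⊕ 1 ∎
      where open ≡-Reasoning

    -- The witness of sizes is only taken apart by a pattern-matching helper: unfolding it inside
    -- types (as a with-abstraction would) makes type checking blow up.
    replacement : ∀ {n} → Agrees n → ∀ S → h₁ + (h₂ + (h₃ + (h₄ + S))) ≡ n → Replacement n S h₁ h₂ h₃ h₄
    replacement agrees S refl = assemble (sizes S)
      where
      assemble : (Σ ℕ λ a → 1 ≤ a × a + (a + (b + (z + S))) ≡ suc (h₁ + (h₂ + (h₃ + (h₄ + S))))) →
        Replacement (h₁ + (h₂ + (h₃ + (h₄ + S)))) S h₁ h₂ h₃ h₄
      assemble (a , 1≤a , a-sizes) =
        a , b , z , 1≤a , 1≤b , 1≤z , a-sizes , nims agrees (proj₁ b,z≤) (proj₂ b,z≤)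
        where
        b,z≤ : b ≤ h₁ + (h₂ + (h₃ + (h₄ + S))) × z ≤ h₁ + (h₂ + (h₃ + (h₄ + S)))
        b,z≤ = replaced≤ a b z S 1≤a a-sizes

  four-heaps : ∀ {n} → Agrees n → ∀ {h₁ h₂ h₃ h₄} S → 1 ≤ h₁ → 1 ≤ h₂ → 1 ≤ h₃ → 1 ≤ h₄ →
    h₁ + (h₂ + (h₃ + (h₄ + S))) ≡ n → Replacement n S h₁ h₂ h₃ h₄
  four-heaps agrees {h₁} {h₂} {h₃} {h₄} S 1≤h₁ 1≤h₂ 1≤h₃ 1≤h₄ sum≡n =
    let h₁≤n , h₂≤n , h₃≤n , h₄≤n = summands≤ h₁ h₂ h₃ h₄ S sum≡n in
    Replace.replacement (heap agrees 1≤h₁ h₁≤n) (heap agrees 1≤h₂ h₂≤n)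
                        (heap agrees 1≤h₃ h₃≤n) (heap agrees 1≤h₄ h₄≤n) agrees S sum≡n

corollary2 : (c : ℕ) → 2 ≤ c → (p : ℕ) → 4 ≤ p → (n : ℕ) → 1 ≤ n →
    (∀ m → 1 ≤ m → m ≤ n → G (cutSet c) m ≡ s c m) →
    ∀ v → InNimSet (cutSet c) n p v → InNimSet (cutSet c) (suc n) p (v ⊕ 1)
corollary2 _ (s≤s (s≤s {n = d} _)) _ (s≤s (s≤s (s≤s (s≤s _)))) n _ agrees v
  (h₁ ∷ h₂ ∷ h₃ ∷ h₄ ∷ rest , 1≤h₁ ∷ 1≤h₂ ∷ 1≤h₃ ∷ 1≤h₄ ∷ 1≤rest , sum≡n , nim≡v) =
  let a , b , z , 1≤a , 1≤b , 1≤z , sum≡1+n , nims≡ =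
        four-heaps d agrees (V.sum rest) 1≤h₁ 1≤h₂ 1≤h₃ 1≤h₄ sum≡n
  in a ∷ a ∷ b ∷ z ∷ rest , 1≤a ∷ 1≤a ∷ 1≤b ∷ 1≤z ∷ 1≤rest , sum≡1+n ,
     trans (⊕-replace (𝒢 d a) (𝒢 d b) (𝒢 d z) (𝒢 d h₁) (𝒢 d h₂) (𝒢 d h₃) (𝒢 d h₄)
              (xorList (V.toList (V.map (𝒢 d) rest))) nims≡)
           (cong (_⊕ 1) nim≡v)
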